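{- In each of the logics DmBL and DmBL$_\ast$, for all $\phi,\psi\in\mathcal{L}$: $\vdash\Box\phi\rightarrow(\psi\times\phi)$. In particular $(\psi|\top)\equiv\psi$.
   Context: Fix a set $\Theta$ of atomic propositions. The language $\mathcal{L}$ is the smallest set containing $\Theta$ and closed under the formation of $\neg\phi$, $\Box\phi$, $\phi\rightarrow\psi$ and the conditional $(\psi|\phi)$. Abbreviations: $\phi\vee\psi=\neg\phi\rightarrow\psi$, $\phi\wedge\psi=\neg(\neg\phi\vee\neg\psi)$, $\phi\leftrightarrow\psi=(\phi\rightarrow\psi)\wedge(\psi\rightarrow\phi)$, $\top=\theta_0\rightarrow\theta_0$ for a fixed $\theta_0\in\Theta$, $\bot=\neg\top$, $\Diamond\phi=\neg\Box\neg\phi$, and (logical independence) $\psi\times\phi=\Box\bigl((\psi|\phi)\leftrightarrow\psi\bigr)$. The theorems ($\vdash$) of DmBL are the smallest set containing all instances of the axiom schemes below and closed under modus ponens (from $\vdash\phi$ and $\vdash\phi\rightarrow\psi$ infer $\vdash\psi$) and necessitation m1 (from $\vdash\phi$ infer $\vdash\Box\phi$): c1 $\phi\rightarrow(\psi\rightarrow\phi)$; c2 $(\eta\rightarrow(\phi\rightarrow\psi))\rightarrow((\eta\rightarrow\phi)\rightarrow(\eta\rightarrow\psi))$; c3 $(\neg\phi\rightarrow\neg\psi)\rightarrow((\neg\phi\rightarrow\psi)\rightarrow\phi)$; m2 $\Box(\phi\rightarrow\psi)\rightarrow(\Box\phi\rightarrow\Box\psi)$; m3 $\Box\phi\rightarrow\phi$;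 b1 $\Box(\phi\rightarrow\psi)\rightarrow(\Box\neg\phi\vee\Box(\psi|\phi))$; b2 $((\psi\rightarrow\eta)|\phi)\rightarrow((\psi|\phi)\rightarrow(\eta|\phi))$; b3 $(\psi|\phi)\rightarrow(\phi\rightarrow\psi)$; b4 $\neg(\neg\psi|\phi)\leftrightarrow(\psi|\phi)$; b5 $(\psi\times\phi)\leftrightarrow(\phi\times\psi)$. The logic DmBL$_\ast$ is defined in the same way but with b5 replaced by the two schemes b5.weak.A $(\psi\times\neg\phi)\leftrightarrow(\psi\times\phi)$ and b5.weak.B $\Box(\psi\leftrightarrow\eta)\rightarrow\Box((\phi|\psi)\leftrightarrow(\phi|\eta))$. $\phi\equiv\psi$ means $\vdash\phi\leftrightarrow\psi$. -}

module Defs where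

open import Level using (Level)

data Form {a : Level} (Θ : Set a) : Set a where
  atom : Θ → Form Θ
  ¬'_  : Form Θ → Form Θ
  □_   : Form Θ → Form Θ
  _⇒_  : Form Θ → Form Θ → Form Θ
  _∣_  : Form Θ → Form Θ → Form Θ

infixr 4 _⇒_
infix 9 ¬'_ □_

module Abbrev {a : Level} {Θ : Set a} (θ₀ : Θ) where
  _∨'_ : Form Θ → Form Θ → Form Θ
  φ ∨' ψ = (¬' φ) ⇒ ψ
  _∧'_ : Form Θ → Form Θ → Form Θ
  φ ∧' ψ = ¬' ((¬' φ) ∨' (¬' ψ))
  _⇔_ : Form Θ → Form Θ → Form Θ
  φ ⇔ ψ = (φ ⇒ ψ) ∧' (ψ ⇒ φ)
  ⊤' : Form Θ
  ⊤' = atom θ₀ ⇒ atom θ₀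
  ⊥' : Form Θ
  ⊥' = ¬' ⊤'
  ◇_ : Form Θ → Form Θ
  ◇ φ = ¬' (□ (¬' φ))
  _⨯_ : Form Θ → Form Θ → Form Θ
  ψ ⨯ φ = □ ((ψ ∣ φ) ⇔ ψ)

data Logic : Set where
  DmBL DmBL* : Logic

module Deriv {a : Level} {Θ : Set a} (θ₀ : Θ) where
  open Abbrev θ₀

  data ⊢[_]_ : Logic → Form Θ → Set a where
    c1 : ∀ {L} φ ψ → ⊢[ L ] (φ ⇒ (ψ ⇒ φ))
    c2 : ∀ {L} η φ ψ → ⊢[ L ] ((η ⇒ (φ ⇒ ψ)) ⇒ ((η ⇒ φ) ⇒ (η ⇒ ψ)))
    c3 : ∀ {L} φ ψ → ⊢[ L ] (((¬' φ) ⇒ (¬' ψ)) ⇒ (((¬' φ) ⇒ ψ) ⇒ φ))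
    m2 : ∀ {L} φ ψ → ⊢[ L ] ((□ (φ ⇒ ψ)) ⇒ ((□ φ) ⇒ (□ ψ)))
    m3 : ∀ {L} φ → ⊢[ L ] ((□ φ) ⇒ φ)
    b1 : ∀ {L} φ ψ → ⊢[ L ] ((□ (φ ⇒ ψ)) ⇒ ((□ (¬' φ)) ∨' (□ (ψ ∣ φ))))
    b2 : ∀ {L} φ ψ η → ⊢[ L ] (((ψ ⇒ η) ∣ φ) ⇒ ((ψ ∣ φ) ⇒ (η ∣ φ)))
    b3 : ∀ {L} φ ψ → ⊢[ L ] ((ψ ∣ φ) ⇒ (φ ⇒ ψ))
    b4 : ∀ {L} φ ψ → ⊢[ L ] ((¬' ((¬' ψ) ∣ φ)) ⇔ (ψ ∣ φ))
    b5 : ∀ φ ψ → ⊢[ DmBL ] ((ψ ⨯ φ) ⇔ (φ ⨯ ψ))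
    b5wA : ∀ φ ψ → ⊢[ DmBL* ] ((ψ ⨯ (¬' φ)) ⇔ (ψ ⨯ φ))
    b5wB : ∀ φ ψ η → ⊢[ DmBL* ] ((□ (ψ ⇔ η)) ⇒ (□ ((φ ∣ ψ) ⇔ (φ ∣ η))))
    mp : ∀ {L φ ψ} → ⊢[ L ] φ → ⊢[ L ] (φ ⇒ ψ) → ⊢[ L ] ψ
    m1 : ∀ {L φ} → ⊢[ L ] φ → ⊢[ L ] (□ φ)

{-# OPTIONS --safe #-}
module Submission where

-- If φ holds then (ψ|φ) and ψ are equivalent: b3 gives (ψ|φ) → ψ, and b3 applied to ¬ψ
-- together with b4 gives ψ → (ψ|φ).  Deriving this equivalence under the hypothesis φ,
-- discharging it and necessitating gives □φ → □((ψ|φ) ↔ ψ), i.e. □φ → ψ × φ.  Taking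
-- φ = ⊤, which is provable and hence necessary, yields (ψ|⊤) ≡ ψ.

open import Defs
open import Level using (Level)
open import Data.Product using (_×_; _,_)
open import Data.List using (List; []; _∷_)
open import Data.List.Membership.Propositional using (_∈_)
open import Data.List.Relation.Unary.Any using (here; there)
open import Relation.Binary.PropositionalEquality using (refl)

module Derivations {a : Level} {Θ : Set a} (θ₀ : Θ) (L : Logic) where
  open Abbrev θ₀
  open Deriv θ₀

  infixl 5 _·_
  infix 3 _⊩_

  -- Derivations from hypotheses, by modus ponens only: necessitation is confined to
  -- theorems, which is what makes the deduction theorem ⇒-intro valid.
  data _⊩_ (Γ : List (Form Θ)) : Form Θ → Set a where
    assume : ∀ {A} → A ∈ Γ → Γ ⊩ A
    axiom  : ∀ {A} → ⊢[ L ] A → Γ ⊩ A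
    _·_    : ∀ {A B} → Γ ⊩ (A ⇒ B) → Γ ⊩ A → Γ ⊩ B

  private variable
    Γ : List (Form Θ)
    A B φ ψ χ : Form Θ

  theorem : [] ⊩ A → ⊢[ L ] A
  theorem (assume ())
  theorem (axiom t) = t
  theorem (f · x)   = mp (theorem x) (theorem f)

  weaken : Γ ⊩ A → (B ∷ Γ) ⊩ A
  weaken (assume p) = assume (there p)
  weaken (axiom t)  = axiom t
  weaken (f · x)    = weaken f · weaken x

  latest : (A ∷ Γ) ⊩ A
  latest = assume (here refl)

  ⇒-refl : Γ ⊩ (A ⇒ A)
  ⇒-refl {A = A} = axiom (c2 A (A ⇒ A) A) · axiom (c1 A (A ⇒ A)) · axiom (c1 A A)

  ⇒-intro : (A ∷ Γ) ⊩ B → Γ ⊩ (A ⇒ B)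
  ⇒-intro (assume (here refl)) = ⇒-refl
  ⇒-intro (assume (there p))   = axiom (c1 _ _) · assume p
  ⇒-intro (axiom t)            = axiom (c1 _ _) · axiom t
  ⇒-intro (f · x)              = axiom (c2 _ _ _) · ⇒-intro f · ⇒-intro x

  ¬¬-elim : Γ ⊩ ¬' (¬' A) → Γ ⊩ A
  ¬¬-elim {A = A} h = axiom (c3 A (¬' A)) · ⇒-intro (weaken h) · ⇒-refl

  ¬¬-intro : Γ ⊩ A → Γ ⊩ ¬' (¬' A)
  ¬¬-intro {A = A} h = axiom (c3 (¬' (¬' A)) A) · ⇒-intro (¬¬-elim latest) · ⇒-intro (weaken h)

  explosion : Γ ⊩ ¬' A → Γ ⊩ A → Γ ⊩ B
  explosion {A = A} {B = B} n x = axiom (c3 B A) · ⇒-intro (weaken n) · ⇒-intro (weaken x)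

  ¬-intro : (A ∷ Γ) ⊩ ¬' B → Γ ⊩ B → Γ ⊩ ¬' A
  ¬-intro {A = A} {B = B} f b =
    axiom (c3 (¬' A) B) · ⇒-intro (weaken (⇒-intro f) · ¬¬-elim latest) · ⇒-intro (weaken b)

  ∧-intro : Γ ⊩ A → Γ ⊩ B → Γ ⊩ A ∧' B
  ∧-intro a b = ¬-intro (latest · weaken (¬¬-intro a)) b

  ∧-elimˡ : Γ ⊩ A ∧' B → Γ ⊩ A
  ∧-elimˡ {A = A} {B = B} h =
    axiom (c3 A (¬' (¬' A) ⇒ ¬' B)) · ⇒-intro (weaken h) · ⇒-intro (⇒-intro (explosion latest (weaken latest)))

  □-mono : ⊢[ L ] (φ ⇒ χ) → ⊢[ L ] (□ φ ⇒ □ χ)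
  □-mono {φ = φ} {χ = χ} t = mp (m1 t) (m2 φ χ)

  conditional-on-fact : Γ ⊩ φ → Γ ⊩ (ψ ∣ φ) ⇔ ψ
  conditional-on-fact {Γ = Γ} {φ = φ} {ψ = ψ} fact = ∧-intro detach attach
    where
    detach : Γ ⊩ (ψ ∣ φ) ⇒ ψ
    detach = ⇒-intro (axiom (b3 φ ψ) · latest · weaken fact)

    attach : Γ ⊩ ψ ⇒ (ψ ∣ φ)
    attach = ⇒-intro (∧-elimˡ (axiom (b4 φ ψ)) · ¬-intro refute latest)
      where
      refute : ((¬' ψ) ∣ φ) ∷ ψ ∷ Γ ⊩ ¬' ψ
      refute = axiom (b3 φ (¬' ψ)) · latest · weaken (weaken fact)

  necessary⇒independent : (φ ψ : Form Θ) → ⊢[ L ] (□ φ ⇒ ψ ⨯ φ)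
  necessary⇒independent φ ψ = □-mono (theorem (⇒-intro (conditional-on-fact latest)))

  independent-of-⊤ : (ψ : Form Θ) → ⊢[ L ] ((ψ ∣ ⊤') ⇔ ψ)
  independent-of-⊤ ψ =
    mp (mp (m1 (theorem ⇒-refl)) (necessary⇒independent ⊤' ψ)) (m3 ((ψ ∣ ⊤') ⇔ ψ))

mainTheorem1 : ∀ {a : Level} {Θ : Set a} (θ₀ : Θ) (L : Logic) →
    ((φ ψ : Form Θ) → Deriv.⊢[_]_ θ₀ L ((□ φ) ⇒ Abbrev._⨯_ θ₀ ψ φ))
    × ((ψ : Form Θ) → Deriv.⊢[_]_ θ₀ L (Abbrev._⇔_ θ₀ (ψ ∣ Abbrev.⊤' θ₀) ψ))
mainTheorem1 θ₀ L = necessary⇒independent , independent-of-⊤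
  where open Derivations θ₀ L
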